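{- Let $0\le r<n$. The simplicial complex $\mathcal{C}_{n,r}$ is a flag complex; its minimal non-faces are exactly the pairs $\{e_{(a_1,b_1)},e_{(a_2,b_2)}\}$ of vertices for which the product $e_{(a_1,b_1)}e_{(a_2,b_2)}$ is not admissible.
   Context: Identify $Q_n=\{0,1\}^n$ with $\{0,\ldots,2^n-1\}$ via binary expansion, with Hamming distance $d_H$. The Stanley--Reisner ideal of $VR(Q_n;r)$ (complex on $Q_n$ with simplices the subsets of $d_H$-diameter $\le r$) is generated by $x_ax_b$, $a<b$, $d_H(a,b)>r$; associate to each an exterior symbol $e_{(a,b)}$. Generators are totally ordered by $x_ax_b<x_cx_d$ if $d_H(a,b)<d_H(c,d)$, lexicographically in the pairs when distances are equal. With $m_i$ the monomial of the $i$-th generator, a product $e_I=e_{i_1}\cdots e_{i_t}$ ($i_1<\cdots<i_t$) is admissible if for every $h$ and every generator index $q>i_h$, $m_q\nmid\operatorname{lcm}(m_{i_1},\ldots,m_{i_h})$. The simplicial complex $\mathcal{C}_{n,r}$ has as vertices the symbols $e_{(a,b)}$ with $r<d_H(a,b)<n$, and a set of vertices spans a simplex iff their product (in increasing order) is admissible. -}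

module Defs where

open import Data.Nat using (ℕ; zero; suc; _+_; _<_; _≤_; _^_; _⊔_; _/_; _%_; _≡ᵇ_)
open import Data.Bool using (Bool; true; false; if_then_else_; _∨_)
open import Data.Product using (_×_; _,_; ∃; ∃-syntax)
open import Data.Sum using (_⊎_)
open import Data.Unit using (⊤)
open import Data.List using (List; []; _∷_; length)
open import Data.List.Relation.Unary.All using (All)
open import Data.List.Relation.Unary.Linked using (Linked)
open import Data.List.Relation.Unary.Unique.Propositional using (Unique)
open import Data.List.Relation.Binary.Permutation.Propositional using (_↭_)
open import Data.List.Relation.Binary.Subset.Propositional using (_⊆_)
open import Relation.Nullary using (¬_)
open import Relation.Binary.PropositionalEquality using (_≡_; _≢_)

hamming : ℕ → ℕ → ℕ → ℕ
hamming zero    a b = 0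
hamming (suc k) a b = (if (a % 2) ≡ᵇ (b % 2) then 0 else 1) + hamming k (a / 2) (b / 2)

-- A pair (a , b) stands for the generator x_a x_b / exterior symbol e_(a,b).
Pair : Set
Pair = ℕ × ℕ

-- Generators of the Stanley–Reisner ideal of VR(Q_n; r):
-- a < b < 2^n and d_H(a,b) > r.
IsGen : ℕ → ℕ → Pair → Set
IsGen n r (a , b) = a < b × b < 2 ^ n × r < hamming n a b

IsVertex : ℕ → ℕ → Pair → Set
IsVertex n r (a , b) = a < b × b < 2 ^ n × r < hamming n a b × hamming n a b < n

_≺[_]_ : Pair → ℕ → Pair → Set
(a , b) ≺[ n ] (c , d) =
  hamming n a b < hamming n c d
  ⊎ (hamming n a b ≡ hamming n c d × (a < c ⊎ (a ≡ c × b < d)))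

Monomial : Set
Monomial = ℕ → ℕ

mono : Pair → Monomial
mono (a , b) x = if (x ≡ᵇ a) ∨ (x ≡ᵇ b) then 1 else 0

one : Monomial
one _ = 0

lcm : Monomial → Monomial → Monomial
lcm f g x = f x ⊔ g x

_∣ₘ_ : Monomial → Monomial → Set
f ∣ₘ g = ∀ x → f x ≤ g x

-- Admissibility condition along the increasing list i_1 < ... < i_t,
-- carrying lcm(m_{i_1},...,m_{i_{h-1}}).
AdmAux : ℕ → ℕ → Monomial → List Pair → Set
AdmAux n r acc [] = ⊤
AdmAux n r acc (g ∷ gs) =
  (∀ q → IsGen n r q → g ≺[ n ] q → ¬ (mono q ∣ₘ lcm acc (mono g)))
  × AdmAux n r (lcm acc (mono g)) gs

Admissible : ℕ → ℕ → List Pair → Set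
Admissible n r L = Linked (λ p q → p ≺[ n ] q) L × All (IsGen n r) L × AdmAux n r one L

VSet : ℕ → ℕ → List Pair → Set
VSet n r S = Unique S × All (IsVertex n r) S

Face : ℕ → ℕ → List Pair → Set
Face n r S = ∃[ L ] (L ↭ S × Admissible n r L)

IsFlag : ℕ → ℕ → Set
IsFlag n r = ∀ S → VSet n r S →
  (∀ v w → v ∈ S → w ∈ S → v ≢ w → Face n r (v ∷ w ∷ [])) → Face n r S
  where open import Data.List.Membership.Propositional using (_∈_)

MinimalNonFace : ℕ → ℕ → List Pair → Set
MinimalNonFace n r S = VSet n r S × ¬ Face n r S
  × (∀ T → VSet n r T → T ⊆ S → length T < length S → Face n r T)

-- The lcm of m_{i_1}, ..., m_{i_h} is squarefree with support the endpoints of those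
-- generators.  If a generator q above i_h divides it, the two endpoints of q lie on
-- generators h₁, h₂ ≼ i_h of the prefix.  If h₁ = h₂ then q = h₁ ≼ i_h, which is absurd;
-- otherwise, say h₁ ≺ h₂, q divides lcm(m_{h₁}, m_{h₂}) and lies above h₂, so the
-- product e_{h₁} e_{h₂} is not admissible.  Hence a vertex set all of whose pairs are
-- faces is a face, and a minimal non-face, having all its proper subsets as faces,
-- must be a pair.
module Submission where

open import Defs
open import Data.Nat using (ℕ; _<_)
open import Data.Product using (_×_; _,_; ∃-syntax)
open import Data.List using (List; []; _∷_)
open import Data.List.Relation.Binary.Permutation.Propositional using (_↭_)
open import Relation.Nullary using (¬_)
open import Relation.Binary.PropositionalEquality using (_≢_)
open import Function.Bundles using (_⇔_)

open import Level using (0ℓ)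
open import Data.Bool using (Bool; true; false; T; if_then_else_)
open import Data.Bool.Properties using (T-∨)
open import Data.Empty using (⊥-elim)
open import Data.Nat using (zero; suc; _≤_; z≤n; s≤s)
open import Data.Nat.Properties
  using (<-irrefl; <-trans; <-asym; <-cmp; <-≤-trans; ⊔-sel; ⊔-comm; m≤m⊔n; m≤n⊔m; ≡ᵇ⇒≡; ≡⇒≡ᵇ)
open import Data.Product using (proj₁; proj₂; map₁; map₂)
open import Data.Product.Relation.Binary.Lex.Strict using (×-Lex; ×-transitive; ×-irreflexive; ×-compare)
open import Data.Product.Relation.Binary.Pointwise.NonDependent using (Pointwise; ≡×≡⇒≡)
open import Data.Sum as Sum using (_⊎_; inj₁; inj₂; [_,_])
open import Data.Unit using (tt)
open import Data.List using (length)
open import Data.List.Membership.Propositional using (_∈_)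
open import Data.List.Relation.Unary.All as All using (All; []; _∷_)
open import Data.List.Relation.Unary.AllPairs as AllPairs using (AllPairs; []; _∷_)
open import Data.List.Relation.Unary.Any using (here; there)
open import Data.List.Relation.Unary.Linked as Linked using (Linked; [-]; _∷_)
open import Data.List.Relation.Unary.Linked.Properties using (AllPairs⇒Linked)
open import Data.List.Relation.Unary.Sorted.TotalOrder.Properties using (Sorted⇒AllPairs; ↗↭↗⇒≋)
open import Data.List.Relation.Unary.Unique.Propositional using (Unique)
open import Data.List.Relation.Binary.Pointwise using (Pointwise-≡⇒≡)
open import Data.List.Relation.Binary.Permutation.Propositional using (↭-refl; ↭-sym; ↭-trans; ↭⇒↭ₛ)
open import Data.List.Relation.Binary.Permutation.Propositional.Properties using (∈-resp-↭; ↭-length)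
import Data.List.Relation.Binary.Permutation.Setoid.Properties as Setoid↭
import Data.List.Sort as Sort
open import Function.Base using (_∘_)
open import Function.Bundles using (mk⇔; Equivalence)
open import Relation.Binary.Bundles using (StrictTotalOrder)
open import Relation.Binary.Core using (Rel)
open import Relation.Binary.Definitions using (Transitive; Irreflexive; Trichotomous; tri<; tri≈; tri>)
open import Relation.Binary.PropositionalEquality using (_≡_; refl; sym; subst; isEquivalence; resp₂; setoid)
import Relation.Binary.Properties.StrictTotalOrder as StrictTotalOrderProperties
open import Relation.Unary using (_⊆_)

-- _≺[ n ]_ is definitionally _<ₖ_ on key n, so it inherits the order properties of a
-- lexicographic product.
Key : Set
Key = ℕ × Pair

_<ₖ_ : Rel Key 0ℓ
_<ₖ_ = ×-Lex _≡_ _<_ (×-Lex _≡_ _<_ _<_)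

key : ℕ → Pair → Key
key n (a , b) = hamming n a b , (a , b)

<ₖ-trans : Transitive _<ₖ_
<ₖ-trans = ×-transitive {_<₂_ = ×-Lex _≡_ _<_ _<_} isEquivalence (resp₂ _<_) <-trans
  (×-transitive {_<₂_ = _<_} isEquivalence (resp₂ _<_) <-trans <-trans)

<ₖ-irrefl : Irreflexive _≡_ _<ₖ_
<ₖ-irrefl refl = ×-irreflexive {_<₁_ = _<_} {_<₂_ = ×-Lex _≡_ _<_ _<_} <-irrefl
  (×-irreflexive {_<₁_ = _<_} {_<₂_ = _<_} <-irrefl <-irrefl) (refl , refl , refl)

<ₖ-compare : Trichotomous (Pointwise _≡_ (Pointwise _≡_ _≡_)) _<ₖ_
<ₖ-compare = ×-compare sym <-cmp (×-compare sym <-cmp <-cmp)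

module _ {n : ℕ} where

  ≺-trans : Transitive (_≺[ n ]_)
  ≺-trans {p} {q} {s} = <ₖ-trans {key n p} {key n q} {key n s}

  ≺-irrefl : Irreflexive _≡_ (_≺[ n ]_)
  ≺-irrefl {p} refl = <ₖ-irrefl {key n p} refl

  ≺⇒≢ : ∀ {p q} → p ≺[ n ] q → p ≢ q
  ≺⇒≢ p≺q p≡q = ≺-irrefl p≡q p≺q

  ≼-≺-trans : ∀ {p q s} → p ≺[ n ] q ⊎ p ≡ q → q ≺[ n ] s → p ≺[ n ] s
  ≼-≺-trans (inj₁ p≺q) q≺s = ≺-trans p≺q q≺s
  ≼-≺-trans (inj₂ refl) q≺s = q≺s

  ≺-compare : Trichotomous _≡_ (_≺[ n ]_)
  ≺-compare p q with <ₖ-compare (key n p) (key n q)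
  ... | tri< p≺q p≉q p⊁q = tri< p≺q (λ { refl → p≉q (refl , refl , refl) }) p⊁q
  ... | tri≈ p⊀q (_ , p≈q) p⊁q = tri≈ p⊀q (≡×≡⇒≡ p≈q) p⊁q
  ... | tri> p⊀q p≉q q≺p = tri> p⊀q (λ { refl → p≉q (refl , refl , refl) }) q≺p

≺-strictTotalOrder : ℕ → StrictTotalOrder 0ℓ 0ℓ 0ℓ
≺-strictTotalOrder n = record
  { Carrier = Pair
  ; _≈_ = _≡_
  ; _<_ = _≺[ n ]_
  ; isStrictTotalOrder = record
    { isStrictPartialOrder = record
      { isEquivalence = isEquivalence
      ; irrefl = ≺-irrefl {n}
      ; trans = ≺-trans {n}
      ; <-resp-≈ = resp₂ _
      }
    ; compare = ≺-compare {n}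
    }
  }

module _ (n : ℕ) where

  open StrictTotalOrderProperties (≺-strictTotalOrder n) using (decTotalOrder; totalOrder)
  open Sort decTotalOrder using (sort; sort-↭; sort-↗)
  open Setoid↭ (setoid Pair) using (Unique-resp-↭)

  strictlySorted-↭ : ∀ S → Unique S → ∃[ L ] (L ↭ S × AllPairs (_≺[ n ]_) L)
  strictlySorted-↭ S S-unique = sort S , sort-↭ S ,
    AllPairs.zipWith strict (Sorted⇒AllPairs totalOrder (sort-↗ S) , L-unique)
    where
    L-unique : Unique (sort S)
    L-unique = Unique-resp-↭ (↭⇒↭ₛ (↭-sym (sort-↭ S))) S-unique
    strict : ∀ {p q} → (p ≺[ n ] q ⊎ p ≡ q) × p ≢ q → p ≺[ n ] q
    strict (inj₁ p≺q , _) = p≺q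
    strict (inj₂ p≡q , p≢q) = ⊥-elim (p≢q p≡q)

  strictlySorted-↭-unique : ∀ {L M} → Linked (_≺[ n ]_) L → Linked (_≺[ n ]_) M → L ↭ M → L ≡ M
  strictlySorted-↭-unique L↗ M↗ L↭M =
    Pointwise-≡⇒≡ (↗↭↗⇒≋ totalOrder (Linked.map inj₁ L↗) (Linked.map inj₁ M↗) (↭⇒↭ₛ L↭M))

_∈ₚ_ : ℕ → Pair → Set
x ∈ₚ (a , b) = x ≡ a ⊎ x ≡ b

endpoints⇒≡ : ∀ {c d a b} → c < d → a < b → c ∈ₚ (a , b) → d ∈ₚ (a , b) → (c , d) ≡ (a , b)
endpoints⇒≡ c<d _   (inj₁ refl) (inj₁ refl) = ⊥-elim (<-irrefl refl c<d)
endpoints⇒≡ _   _   (inj₁ refl) (inj₂ refl) = refl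
endpoints⇒≡ c<d a<b (inj₂ refl) (inj₁ refl) = ⊥-elim (<-asym c<d a<b)
endpoints⇒≡ c<d _   (inj₂ refl) (inj₂ refl) = ⊥-elim (<-irrefl refl c<d)

indicator : Bool → ℕ
indicator b = if b then 1 else 0

indicator≤1 : ∀ b → indicator b ≤ 1
indicator≤1 true = s≤s z≤n
indicator≤1 false = z≤n

T⇒indicator-pos : ∀ {b} → T b → 0 < indicator b
T⇒indicator-pos {true} _ = s≤s z≤n

indicator-pos⇒T : ∀ {b} → 0 < indicator b → T b
indicator-pos⇒T {true} _ = tt

mono≤1 : ∀ p x → mono p x ≤ 1
mono≤1 (a , b) x = indicator≤1 _

∈ₚ⇒mono-pos : ∀ {p x} → x ∈ₚ p → 0 < mono p x
∈ₚ⇒mono-pos {a , b} {x} x∈p =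
  T⇒indicator-pos (Equivalence.from T-∨ (Sum.map (≡⇒≡ᵇ x a) (≡⇒≡ᵇ x b) x∈p))

mono-pos⇒∈ₚ : ∀ {p x} → 0 < mono p x → x ∈ₚ p
mono-pos⇒∈ₚ {a , b} {x} pos =
  Sum.map (≡ᵇ⇒≡ x a) (≡ᵇ⇒≡ x b) (Equivalence.to T-∨ (indicator-pos⇒T pos))

lcm-pos⁻ : ∀ f g x → 0 < lcm f g x → 0 < f x ⊎ 0 < g x
lcm-pos⁻ f g x pos = Sum.map (λ e → subst (0 <_) e pos) (λ e → subst (0 <_) e pos) (⊔-sel (f x) (g x))

lcm-posˡ : ∀ f g {x} → 0 < f x → 0 < lcm f g x
lcm-posˡ f g {x} pos = <-≤-trans pos (m≤m⊔n (f x) (g x))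

lcm-posʳ : ∀ f g {x} → 0 < g x → 0 < lcm f g x
lcm-posʳ f g {x} pos = <-≤-trans pos (m≤n⊔m (f x) (g x))

mono∣ₘ⇒pos : ∀ {p f x} → mono p ∣ₘ f → x ∈ₚ p → 0 < f x
mono∣ₘ⇒pos {x = x} p∣f x∈p = <-≤-trans (∈ₚ⇒mono-pos x∈p) (p∣f x)

pos⇒mono∣ₘ : ∀ {c d f} → 0 < f c → 0 < f d → mono (c , d) ∣ₘ f
pos⇒mono∣ₘ {c} {d} {f} fc fd x = bounded (mono≤1 (c , d) x) (endpoint-pos ∘ mono-pos⇒∈ₚ)
  where
  endpoint-pos : x ∈ₚ (c , d) → 0 < f x
  endpoint-pos (inj₁ refl) = fc
  endpoint-pos (inj₂ refl) = fd
  bounded : ∀ {m k} → m ≤ 1 → (0 < m → 0 < k) → m ≤ k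
  bounded {zero} _ _ = z≤n
  bounded {suc zero} _ pos = pos (s≤s z≤n)
  bounded {suc (suc _)} (s≤s ()) _

∈ₚ⇒mono∣ₘlcm : ∀ {c d p p′} → c ∈ₚ p → d ∈ₚ p′ → mono (c , d) ∣ₘ lcm (mono p) (mono p′)
∈ₚ⇒mono∣ₘlcm {c} {d} {p} {p′} c∈p d∈p′ =
  pos⇒mono∣ₘ (lcm-posˡ (mono p) (mono p′) {c} (∈ₚ⇒mono-pos c∈p))
             (lcm-posʳ (mono p) (mono p′) {d} (∈ₚ⇒mono-pos d∈p′))

∣ₘ-lcm-comm : ∀ {f} g h → f ∣ₘ lcm g h → f ∣ₘ lcm h g
∣ₘ-lcm-comm {f} g h f∣gh x = subst (f x ≤_) (⊔-comm (g x) (h x)) (f∣gh x)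

NoLaterDivisor : ℕ → ℕ → Pair → Monomial → Set
NoLaterDivisor n r g f = ∀ q → IsGen n r q → g ≺[ n ] q → ¬ (mono q ∣ₘ f)

SupportedBy : (Pair → Set) → Monomial → Set
SupportedBy P f = ∀ x → 0 < f x → ∃[ h ] (P h × x ∈ₚ h)

supportedBy-mono : ∀ {P Q f} → P ⊆ Q → SupportedBy P f → SupportedBy Q f
supportedBy-mono P⊆Q sup x pos = map₂ (map₁ P⊆Q) (sup x pos)

supportedBy-lcm : ∀ {P f g} → SupportedBy P f → P g → SupportedBy P (lcm f (mono g))
supportedBy-lcm {f = f} {g} sup Pg x pos =
  [ sup x , (λ pos′ → g , Pg , mono-pos⇒∈ₚ {g} pos′) ] (lcm-pos⁻ f (mono g) x pos)

module _ (n r : ℕ) {G : Pair → Set} (G⊆gen : G ⊆ IsGen n r)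
         (pairwise : ∀ {x y} → G x → G y → x ≺[ n ] y → NoLaterDivisor n r y (lcm (mono x) (mono y)))
         where

  supported⇒noLaterDivisor : ∀ {g f} → SupportedBy (λ h → G h × (h ≺[ n ] g ⊎ h ≡ g)) f →
                             NoLaterDivisor n r g f
  supported⇒noLaterDivisor {g} sup q@(c , d) q-gen@(c<d , _) g≺q q∣f
    with sup c (mono∣ₘ⇒pos q∣f (inj₁ refl)) | sup d (mono∣ₘ⇒pos q∣f (inj₂ refl))
  ... | h₁ , (G₁ , h₁≼g) , c∈h₁ | h₂ , (G₂ , h₂≼g) , d∈h₂ with ≺-compare {n} h₁ h₂
  ... | tri< h₁≺h₂ _ _ = pairwise G₁ G₂ h₁≺h₂ q q-gen (≼-≺-trans {n} h₂≼g g≺q)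
          (∈ₚ⇒mono∣ₘlcm c∈h₁ d∈h₂)
  ... | tri> _ _ h₂≺h₁ = pairwise G₂ G₁ h₂≺h₁ q q-gen (≼-≺-trans {n} h₁≼g g≺q)
          (∣ₘ-lcm-comm (mono h₁) (mono h₂) (∈ₚ⇒mono∣ₘlcm c∈h₁ d∈h₂))
  ... | tri≈ _ refl _ =
          ≺-irrefl {n} (sym (endpoints⇒≡ c<d (proj₁ (G⊆gen G₁)) c∈h₁ d∈h₂)) (≼-≺-trans {n} h₁≼g g≺q)

  supported⇒AdmAux : ∀ f L → SupportedBy (λ h → G h × All (h ≺[ n ]_) L) f →
                     All G L → AllPairs (_≺[ n ]_) L → AdmAux n r f L
  supported⇒AdmAux f [] _ _ _ = tt
  supported⇒AdmAux f (g ∷ L) sup (Gg ∷ GL) (g≺L ∷ L↗) =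
    supported⇒noLaterDivisor
      (supportedBy-lcm (supportedBy-mono (map₂ (inj₁ ∘ All.head)) sup) (Gg , inj₂ refl)) ,
    supported⇒AdmAux (lcm f (mono g)) L
      (supportedBy-lcm (supportedBy-mono (map₂ All.tail) sup) (Gg , g≺L)) GL L↗

  pairwise⇒admissible : ∀ {L} → All G L → AllPairs (_≺[ n ]_) L → Admissible n r L
  pairwise⇒admissible GL L↗ =
    AllPairs⇒Linked L↗ , All.map G⊆gen GL , supported⇒AdmAux one _ (λ _ ()) GL L↗

module _ (n r : ℕ) where

  vertex⇒gen : IsVertex n r ⊆ IsGen n r
  vertex⇒gen (a<b , b<2ⁿ , r<d , _) = a<b , b<2ⁿ , r<d

  Face-resp-↭ : ∀ {S T} → S ↭ T → Face n r S → Face n r T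
  Face-resp-↭ S↭T (L , L↭S , L-adm) = L , ↭-trans L↭S S↭T , L-adm

  edgeFace⇒noLaterDivisor : ∀ {x y} → x ≺[ n ] y → Face n r (x ∷ y ∷ []) →
                            NoLaterDivisor n r y (lcm (mono x) (mono y))
  edgeFace⇒noLaterDivisor x≺y (L , L↭xy , L↗ , _ , L-adm)
    with strictlySorted-↭-unique n L↗ (x≺y ∷ [-]) L↭xy
  ... | refl = proj₁ (proj₂ L-adm)

  isFlag : IsFlag n r
  isFlag S (S-unique , S-vertices) edgeFace with strictlySorted-↭ n S S-unique
  ... | L , L↭S , L↗ = L , L↭S , pairwise⇒admissible n r {G = _∈ S}
          (vertex⇒gen ∘ All.lookup S-vertices)
          (λ x∈S y∈S x≺y → edgeFace⇒noLaterDivisor x≺y (edgeFace _ _ x∈S y∈S (≺⇒≢ {n} x≺y)))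
          (All.tabulate (∈-resp-↭ L↭S)) L↗

  short⇒face : ∀ {T} → VSet n r T → length T < 2 → Face n r T
  short⇒face {T} T-vset |T|<2 =
    isFlag T T-vset (λ v w v∈T w∈T v≢w → ⊥-elim (v≢w (∈-short⇒≡ |T|<2 v∈T w∈T)))
    where
    ∈-short⇒≡ : ∀ {U v w} → length U < 2 → v ∈ U → w ∈ U → v ≡ w
    ∈-short⇒≡ {_ ∷ []} _ (here refl) (here refl) = refl
    ∈-short⇒≡ {_ ∷ _ ∷ _} (s≤s (s≤s ())) _ _

  minimalNonFace⇒edge : ∀ S → MinimalNonFace n r S →
                        ∃[ v ] ∃[ w ] (v ≢ w × S ↭ v ∷ w ∷ [] × ¬ Face n r (v ∷ w ∷ []))
  minimalNonFace⇒edge [] (S-vset , ¬face , _) = ⊥-elim (¬face (short⇒face S-vset (s≤s z≤n)))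
  minimalNonFace⇒edge (_ ∷ []) (S-vset , ¬face , _) = ⊥-elim (¬face (short⇒face S-vset (s≤s (s≤s z≤n))))
  minimalNonFace⇒edge (v ∷ w ∷ []) (((v≢w ∷ []) ∷ _ , _) , ¬face , _) = v , w , v≢w , ↭-refl , ¬face
  minimalNonFace⇒edge S@(_ ∷ _ ∷ _ ∷ _) (S-vset@(_ , S-vertices) , ¬face , proper⇒face) =
    ⊥-elim (¬face (isFlag S S-vset edgeFace))
    where
    edgeFace : ∀ v w → v ∈ S → w ∈ S → v ≢ w → Face n r (v ∷ w ∷ [])
    edgeFace v w v∈S w∈S v≢w = proper⇒face (v ∷ w ∷ [])
      (((v≢w ∷ []) ∷ [] ∷ []) , All.lookup S-vertices v∈S ∷ All.lookup S-vertices w∈S ∷ [])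
      (λ { (here refl) → v∈S ; (there (here refl)) → w∈S })
      (s≤s (s≤s (s≤s z≤n)))

  edge⇒minimalNonFace : ∀ S → VSet n r S →
                        ∃[ v ] ∃[ w ] (v ≢ w × S ↭ v ∷ w ∷ [] × ¬ Face n r (v ∷ w ∷ [])) →
                        MinimalNonFace n r S
  edge⇒minimalNonFace S S-vset (v , w , _ , S↭vw , ¬face) =
    S-vset , ¬face ∘ Face-resp-↭ S↭vw ,
    λ T T-vset _ |T|<|S| → short⇒face T-vset (subst (length T <_) (↭-length S↭vw) |T|<|S|)

mainTheorem9 : ∀ (n r : ℕ) → r < n →
    IsFlag n r
    × (∀ (S : List Pair) → VSet n r S →
        (MinimalNonFace n r S
          ⇔ (∃[ v ] ∃[ w ] (v ≢ w × S ↭ (v ∷ w ∷ []) × ¬ Face n r (v ∷ w ∷ [])))))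
mainTheorem9 n r _ =
  isFlag n r , λ S S-vset → mk⇔ (minimalNonFace⇒edge n r S) (edge⇒minimalNonFace n r S S-vset)
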